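{- Let $G$ be a graph and let $u,v\in V(G)$. If no maximal induced matching of $G$ covers both $u$ and $v$, then $|M_{G_{u\rightarrow v}}|\geq |M_G|$ or $|M_{G_{v\rightarrow u}}|\geq |M_G|$.
   Context: All graphs are finite, simple and undirected; $N_G(x)$ denotes the open neighborhood of $x$. A matching in $G$ is a set of edges no two of which share an endpoint; it covers a vertex $x$ if $x$ is an endpoint of one of its edges; it is induced if the subgraph of $G$ induced by the endpoints of its edges is $1$-regular; an induced matching is maximal if it is not properly contained in another induced matching of $G$. $M_G$ denotes the set of all maximal induced matchings of $G$. For two non-adjacent vertices $u,v$ of $G$, $G_{u\rightarrow v}$ is the graph obtained from $G$ by deleting the edge $ux$ for every $x\in N_G(u)\setminus N_G(v)$ and adding the edge $uy$ for every $y\in N_G(v)\setminus N_G(u)$ (so that $u$ and $v$ have the same neighborhood). (Note that if $u,v$ were adjacent, the edge $uv$ would lie in some maximal induced matching, so the hypothesis forces $u,v$ to be non-adjacent.) -}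

module Defs where

open import Data.Nat using (ℕ)
open import Data.Bool using (Bool; true; false)
open import Data.Fin using (Fin; _≟_)
open import Data.Vec using (Vec; lookup)
open import Data.Product using (Σ; _×_; _,_; ∃)
open import Data.Empty using (⊥-elim)
open import Relation.Nullary using (¬_; yes; no)
open import Relation.Binary.PropositionalEquality using (_≡_; refl)

record Graph (n : ℕ) : Set where
  field
    adj   : Fin n → Fin n → Bool
    adj-sym : ∀ x y → adj x y ≡ adj y x
    adj-irr : ∀ x → adj x x ≡ false
open Graph public

-- Edge sets of G are represented by n×n Boolean matrices
-- (symmetric, contained in E(G)); Vec-based so ≡ is extensional.
Matrix : ℕ → Set
Matrix n = Vec (Vec Bool n) n

_∋_,_ : ∀ {n} → Matrix n → Fin n → Fin n → Bool
M ∋ x , y = lookup (lookup M x) y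

IsEdgeSet : ∀ {n} → Graph n → Matrix n → Set
IsEdgeSet G M = (∀ x y → M ∋ x , y ≡ M ∋ y , x)
              × (∀ x y → M ∋ x , y ≡ true → adj G x y ≡ true)

Covers : ∀ {n} → Matrix n → Fin n → Set
Covers M x = ∃ λ y → M ∋ x , y ≡ true

IsMatching : ∀ {n} → Graph n → Matrix n → Set
IsMatching G M = IsEdgeSet G M
               × (∀ x y z → M ∋ x , y ≡ true → M ∋ x , z ≡ true → y ≡ z)

-- induced: the subgraph of G induced by the covered vertices is 1-regular,
-- i.e. every covered vertex has exactly one G-neighbour among covered vertices
IsInducedMatching : ∀ {n} → Graph n → Matrix n → Set
IsInducedMatching G M =
  IsMatching G M
  × (∀ x → Covers M x →
       Σ _ λ y → Covers M y × adj G x y ≡ true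
         × (∀ z → Covers M z → adj G x z ≡ true → z ≡ y))

_⊆ₘ_ : ∀ {n} → Matrix n → Matrix n → Set
M ⊆ₘ M' = ∀ x y → M ∋ x , y ≡ true → M' ∋ x , y ≡ true

IsMaxInducedMatching : ∀ {n} → Graph n → Matrix n → Set
IsMaxInducedMatching G M =
  IsInducedMatching G M
  × (∀ M' → IsInducedMatching G M' → M ⊆ₘ M' → M ≡ M')

-- |{M | P M}| ≤ |{M | Q M}| for finite sets of matrices, via an injection
_≤card_ : ∀ {n} → (Matrix n → Set) → (Matrix n → Set) → Set
P ≤card Q = Σ _ λ (f : Matrix _ → Matrix _) →
    (∀ M → P M → Q (f M))
  × (∀ M M' → P M → P M' → f M ≡ f M' → M ≡ M')

-- G_{u→v}: u gets exactly the neighbourhood N_G(v); everything else unchanged.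
shiftAdj : ∀ {n} → Graph n → Fin n → Fin n → Fin n → Fin n → Bool
shiftAdj G u v x y with x ≟ u | y ≟ u
... | yes _ | yes _ = false
... | yes _ | no _  = adj G v y
... | no _  | yes _ = adj G v x
... | no _  | no _  = adj G x y

shiftSym : ∀ {n} (G : Graph n) u v x y → shiftAdj G u v x y ≡ shiftAdj G u v y x
shiftSym G u v x y with x ≟ u | y ≟ u
... | yes _ | yes _ = refl
... | yes _ | no _  = refl
... | no _  | yes _ = refl
... | no _  | no _  = adj-sym G x y

shiftIrr : ∀ {n} (G : Graph n) u v x → shiftAdj G u v x x ≡ false
shiftIrr G u v x with x ≟ u
... | yes _ = refl
... | no _  = adj-irr G x

_[_⇒_] : ∀ {n} → Graph n → Fin n → Fin n → Graph n
G [ u ⇒ v ] = record { adj = shiftAdj G u v ; adj-sym = shiftSym G u v ; adj-irr = shiftIrr G u v }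

module Submission where

-- Let G' = G [ u ⇒ v ].  In G' the vertices u and v are twins: G' is the
-- pull-back of G along the map ρ sending u to v and fixing everything else,
-- so the transposition σ of u and v is an automorphism of G'.  The proof is
-- an explicit injection M_G → M_G'.
--
--  * A maximal induced matching of G that avoids u is still one of G'
--    (`avoiding-u-stays-maximal`): on vertices other than u the two graphs
--    agree, and an induced matching M' ⊇ M of G' covering u cannot cover its
--    twin v, so σ moves M' to an induced matching of G that contains M and
--    covers v, contradicting the maximality of M.
--  * Since M_G is finite, the matchings covering u and those covering v are
--    comparable in number; say (by symmetry) there is an injection g from the
--    former to the latter.  Send M to M itself if M avoids u, and to the
--    σ-image of g M otherwise.  As no maximal induced matching covers both u
--    and v, g M avoids u, so its σ-image is a maximal induced matching of G'
--    that covers u; hence both kinds of images are disjoint and the map is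
--    injective (`injection-into-shift`).

open import Defs
open import Data.Nat using (ℕ; zero; suc)
open import Data.Bool using (Bool; true; false)
import Data.Bool.Properties as Bool
open import Data.Fin using (Fin; _≟_)
open import Data.Fin.Properties using (any?; all?)
open import Data.Fin.Permutation.Components using (transpose)
open import Data.Vec using (Vec; []; _∷_; lookup; tabulate)
open import Data.Vec.Properties using (lookup∘tabulate; tabulate∘lookup; tabulate-cong; ≡-dec)
open import Data.List using (List; []; _∷_; filter; deduplicate; cartesianProductWith)
open import Data.List.Membership.Propositional using (_∈_; _∉_)
open import Data.List.Membership.Propositional.Properties
  using (∈-filter⁺; ∈-filter⁻; ∈-deduplicate⁺; ∈-deduplicate⁻; ∈-cartesianProductWith⁺)
open import Data.List.Relation.Unary.Any using (here; there)
open import Data.List.Relation.Unary.All using (All)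
import Data.List.Relation.Unary.All as All
open import Data.List.Relation.Unary.AllPairs using ([]; _∷_)
open import Data.List.Relation.Unary.Unique.Propositional using (Unique)
import Data.List.Relation.Unary.Unique.DecPropositional.Properties as UniqueProperties
open import Data.Product using (Σ; _×_; _,_; proj₁; proj₂)
open import Data.Sum using (_⊎_; inj₁; inj₂) renaming (map to ⊎-map)
open import Data.Empty using (⊥-elim)
open import Relation.Nullary using (¬_; Dec; yes; no)
open import Relation.Nullary.Decidable using (_×-dec_; _→-dec_; dec-true)
open import Relation.Unary using (Decidable)
open import Relation.Binary using (DecidableEquality)
open import Relation.Binary.PropositionalEquality
  using (_≡_; _≢_; refl; sym; trans; subst; cong; cong₂; module ≡-Reasoning)

-- Cardinalities of finite sets are totally ordered.
module FiniteComparison {A : Set} (_≟ᴬ_ : DecidableEquality A) where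
  open UniqueProperties _≟ᴬ_ using (deduplicate-!)

  _≼_ : (A → Set) → (A → Set) → Set
  P ≼ Q = Σ (A → A) λ f → (∀ a → P a → Q (f a))
                          × (∀ a a' → P a → P a' → f a ≡ f a' → a ≡ a')

  Injection : List A → List A → Set
  Injection xs ys = Σ (A → A) λ f → (∀ {a} → a ∈ xs → f a ∈ ys)
                     × (∀ {a a'} → a ∈ xs → a' ∈ xs → f a ≡ f a' → a ≡ a')

  from-empty : ∀ ys → Injection [] ys
  from-empty ys = (λ a → a) , (λ ()) , (λ ())

  extend : ∀ {x y xs ys} → y ∉ ys → Injection xs ys → Injection (x ∷ xs) (y ∷ ys)
  extend {x} {y} {xs} {ys} y∉ys (f , into , inj) = f' , into' , inj'
    where
    f' : A → A
    f' a with a ≟ᴬ x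
    ... | yes _ = y
    ... | no _  = f a

    tail : ∀ {a} → a ∈ x ∷ xs → a ≢ x → a ∈ xs
    tail (here a≡x) a≢x = ⊥-elim (a≢x a≡x)
    tail (there p)  _   = p

    into' : ∀ {a} → a ∈ x ∷ xs → f' a ∈ y ∷ ys
    into' {a} p with a ≟ᴬ x
    ... | yes _  = here refl
    ... | no a≢x = there (into (tail p a≢x))

    inj' : ∀ {a a'} → a ∈ x ∷ xs → a' ∈ x ∷ xs → f' a ≡ f' a' → a ≡ a'
    inj' {a} {a'} p p' e with a ≟ᴬ x | a' ≟ᴬ x
    ... | yes a≡x | yes a'≡x = trans a≡x (sym a'≡x)
    ... | yes _   | no a'≢x  = ⊥-elim (y∉ys (subst (_∈ ys) (sym e) (into (tail p' a'≢x))))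
    ... | no a≢x  | yes _    = ⊥-elim (y∉ys (subst (_∈ ys) e (into (tail p a≢x))))
    ... | no a≢x  | no a'≢x  = inj (tail p a≢x) (tail p' a'≢x) e

  -- Lists without repetitions are compared by pairing off their entries in
  -- order until one of them runs out.
  compare-unique : ∀ {xs ys} → Unique xs → Unique ys → Injection xs ys ⊎ Injection ys xs
  compare-unique []              _               = inj₁ (from-empty _)
  compare-unique (_ ∷ _)         []              = inj₂ (from-empty _)
  compare-unique (x-fresh ∷ xs!) (y-fresh ∷ ys!) =
    ⊎-map (extend (fresh y-fresh)) (extend (fresh x-fresh)) (compare-unique xs! ys!)
    where
    fresh : ∀ {z zs} → All (z ≢_) zs → z ∉ zs
    fresh distinct z∈zs = All.lookup distinct z∈zs refl

  compare : (everything : List A) → (∀ a → a ∈ everything) →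
            {P Q : A → Set} → Decidable P → Decidable Q → P ≼ Q ⊎ Q ≼ P
  compare everything complete P? Q? =
    ⊎-map (restrict P? Q?) (restrict Q? P?) (compare-unique (deduplicate-! _) (deduplicate-! _))
    where
    listing : ∀ {P : A → Set} → Decidable P → List A
    listing P? = deduplicate _≟ᴬ_ (filter P? everything)

    listed : ∀ {P : A → Set} (P? : Decidable P) a → P a → a ∈ listing P?
    listed P? a p = ∈-deduplicate⁺ _≟ᴬ_ (∈-filter⁺ P? (complete a) p)

    unlisted : ∀ {P : A → Set} (P? : Decidable P) {a} → a ∈ listing P? → P a
    unlisted P? p = proj₂ (∈-filter⁻ P? {xs = everything} (∈-deduplicate⁻ _≟ᴬ_ _ p))

    restrict : ∀ {P Q : A → Set} (P? : Decidable P) (Q? : Decidable Q) →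
               Injection (listing P?) (listing Q?) → P ≼ Q
    restrict P? Q? (f , into , inj) =
        f
      , (λ a p → unlisted Q? (into (listed P? a p)))
      , (λ a a' p p' → inj (listed P? a p) (listed P? a' p'))

vectors : ∀ {A : Set} → List A → (n : ℕ) → List (Vec A n)
vectors as zero    = [] ∷ []
vectors as (suc n) = cartesianProductWith _∷_ as (vectors as n)

vectors-complete : ∀ {A : Set} (as : List A) → (∀ a → a ∈ as) →
                   ∀ n (w : Vec A n) → w ∈ vectors as n
vectors-complete as complete zero    []      = here refl
vectors-complete as complete (suc n) (a ∷ w) =
  ∈-cartesianProductWith⁺ _∷_ (complete a) (vectors-complete as complete n w)

module _ {n : ℕ} where

  matrices : List (Matrix n)
  matrices = vectors (vectors (true ∷ false ∷ []) n) n

  matrices-complete : ∀ M → M ∈ matrices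
  matrices-complete = vectors-complete _ (vectors-complete _ bool-listed n) n
    where
    bool-listed : ∀ b → b ∈ true ∷ false ∷ []
    bool-listed true  = here refl
    bool-listed false = there (here refl)

  _≟ₘ_ : DecidableEquality (Matrix n)
  _≟ₘ_ = ≡-dec (≡-dec Bool._≟_)

  ∀-matrix? : {P : Matrix n → Set} → (∀ M → Dec (P M)) → Dec (∀ M → P M)
  ∀-matrix? {P} P? with All.all? P? matrices
  ... | yes all = yes (λ M → All.lookup all (matrices-complete M))
  ... | no ¬all = no (λ every → ¬all (All.tabulate (λ {M} _ → every M)))

  is-true? : (b : Bool) → Dec (b ≡ true)
  is-true? b = b Bool.≟ true

  covers? : ∀ M x → Dec (Covers {n} M x)
  covers? M x = any? λ y → is-true? (M ∋ x , y)

  edge-set? : ∀ G M → Dec (IsEdgeSet {n} G M)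
  edge-set? G M =
          (all? λ x → all? λ y → (M ∋ x , y) Bool.≟ (M ∋ y , x))
    ×-dec (all? λ x → all? λ y → is-true? (M ∋ x , y) →-dec is-true? (adj G x y))

  matching? : ∀ G M → Dec (IsMatching {n} G M)
  matching? G M = edge-set? G M ×-dec
    (all? λ x → all? λ y → all? λ z →
       is-true? (M ∋ x , y) →-dec (is-true? (M ∋ x , z) →-dec (y ≟ z)))

  induced? : ∀ G M → Dec (IsInducedMatching {n} G M)
  induced? G M = matching? G M ×-dec
    (all? λ x → covers? M x →-dec any? λ y → covers? M y ×-dec is-true? (adj G x y)
       ×-dec all? λ z → covers? M z →-dec (is-true? (adj G x z) →-dec (z ≟ y)))

  ⊆ₘ? : ∀ M M' → Dec (_⊆ₘ_ {n} M M')
  ⊆ₘ? M M' = all? λ x → all? λ y → is-true? (M ∋ x , y) →-dec is-true? (M' ∋ x , y)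

  maximal? : ∀ G M → Dec (IsMaxInducedMatching {n} G M)
  maximal? G M = induced? G M ×-dec
    ∀-matrix? λ M' → induced? G M' →-dec (⊆ₘ? M M' →-dec (M ≟ₘ M'))

  fromFun : (Fin n → Fin n → Bool) → Matrix n
  fromFun f = tabulate λ x → tabulate λ y → f x y

  fromFun-∋ : ∀ f x y → fromFun f ∋ x , y ≡ f x y
  fromFun-∋ f x y = trans (cong (λ row → lookup row y) (lookup∘tabulate _ x)) (lookup∘tabulate _ y)

  matrix-ext : ∀ {M M' : Matrix n} → (∀ x y → M ∋ x , y ≡ M' ∋ x , y) → M ≡ M'
  matrix-ext {M} {M'} same = begin
    M                                   ≡⟨ sym (entries M) ⟩
    fromFun (λ x y → M ∋ x , y)         ≡⟨ tabulate-cong (λ x → tabulate-cong (same x)) ⟩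
    fromFun (λ x y → M' ∋ x , y)        ≡⟨ entries M' ⟩
    M'                                  ∎
    where
    open ≡-Reasoning
    entries : ∀ K → fromFun (λ x y → K ∋ x , y) ≡ K
    entries K = trans (tabulate-cong (λ x → tabulate∘lookup (lookup K x))) (tabulate∘lookup K)

  partner-covered : ∀ G M {x y} → IsEdgeSet {n} G M → M ∋ x , y ≡ true → Covers M y
  partner-covered G M {x} {y} (symmetric , _) xy = x , trans (symmetric y x) xy

  covers-mono : ∀ (M M' : Matrix n) {x} → M ⊆ₘ M' → Covers M x → Covers M' x
  covers-mono M M' {x} M⊆M' (y , xy) = y , M⊆M' x y xy

  transfer-induced : ∀ (G H : Graph n) M →
    (∀ x y → Covers M x → Covers M y → adj G x y ≡ adj H x y) →
    IsInducedMatching G M → IsInducedMatching H M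
  transfer-induced G H M agree (((symmetric , edges) , unique) , induced) =
    ((symmetric , edges') , unique) , induced'
    where
    edges' : ∀ x y → M ∋ x , y ≡ true → adj H x y ≡ true
    edges' x y xy = trans (sym (agree x y (y , xy) (x , trans (symmetric y x) xy))) (edges x y xy)

    induced' : ∀ x → Covers M x → Σ _ λ y → Covers M y × adj H x y ≡ true
                 × (∀ z → Covers M z → adj H x z ≡ true → z ≡ y)
    induced' x cx with induced x cx
    ... | y , cy , xy , only-y =
      y , cy , trans (sym (agree x y cx cy)) xy ,
      λ z cz xz → only-y z cz (trans (agree x z cx cz) xz)

  common-neighbour : ∀ H M {w a b} → IsInducedMatching {n} H M → Covers M w →
    Covers M a → Covers M b → adj H w a ≡ true → adj H w b ≡ true → a ≡ b
  common-neighbour H M (_ , induced) cw ca cb wa wb with induced _ cw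
  ... | _ , _ , _ , only = trans (only _ ca wa) (sym (only _ cb wb))

  module Automorphism (H : Graph n) (σ : Fin n → Fin n) (σ-involutive : ∀ x → σ (σ x) ≡ x)
                      (σ-preserves : ∀ x y → adj H (σ x) (σ y) ≡ adj H x y) where

    act : Matrix n → Matrix n
    act M = fromFun λ x y → M ∋ σ x , σ y

    act-involutive : ∀ M → act (act M) ≡ M
    act-involutive M = matrix-ext λ x y →
      trans (fromFun-∋ _ x y)
        (trans (fromFun-∋ _ (σ x) (σ y)) (cong₂ (M ∋_,_) (σ-involutive x) (σ-involutive y)))

    act-injective : ∀ M M' → act M ≡ act M' → M ≡ M'
    act-injective M M' e = trans (sym (act-involutive M)) (trans (cong act e) (act-involutive M'))

    σ-injective : ∀ {x y} → σ x ≡ σ y → x ≡ y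
    σ-injective {x} {y} e = trans (sym (σ-involutive x)) (trans (cong σ e) (σ-involutive y))

    covers-act : ∀ M x → Covers M (σ x) → Covers (act M) x
    covers-act M x (t , p) =
      σ t , trans (fromFun-∋ _ x (σ t)) (trans (cong (M ∋ σ x ,_) (σ-involutive t)) p)

    covers-act⁻ : ∀ M x → Covers (act M) x → Covers M (σ x)
    covers-act⁻ M x (t , p) = σ t , trans (sym (fromFun-∋ _ x t)) p

    act-induced : ∀ M → IsInducedMatching H M → IsInducedMatching H (act M)
    act-induced M (((symmetric , edges) , unique) , induced) =
      ((symmetric' , edges') , unique') , induced'
      where
      entry : ∀ x y → act M ∋ x , y ≡ true → M ∋ σ x , σ y ≡ true
      entry x y p = trans (sym (fromFun-∋ _ x y)) p

      symmetric' : ∀ x y → act M ∋ x , y ≡ act M ∋ y , x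
      symmetric' x y = trans (fromFun-∋ _ x y) (trans (symmetric (σ x) (σ y)) (sym (fromFun-∋ _ y x)))

      edges' : ∀ x y → act M ∋ x , y ≡ true → adj H x y ≡ true
      edges' x y p = trans (sym (σ-preserves x y)) (edges (σ x) (σ y) (entry x y p))

      unique' : ∀ x y z → act M ∋ x , y ≡ true → act M ∋ x , z ≡ true → y ≡ z
      unique' x y z p q = σ-injective (unique (σ x) (σ y) (σ z) (entry x y p) (entry x z q))

      induced' : ∀ x → Covers (act M) x → Σ _ λ y → Covers (act M) y × adj H x y ≡ true
                   × (∀ z → Covers (act M) z → adj H x z ≡ true → z ≡ y)
      induced' x cx with induced (σ x) (covers-act⁻ M x cx)
      ... | y , cy , xy , only-y =
          σ y
        , covers-act M (σ y) (subst (Covers M) (sym (σ-involutive y)) cy)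
        , trans (sym (σ-preserves x (σ y))) (trans (cong (adj H (σ x)) (σ-involutive y)) xy)
        , λ z cz xz → trans (sym (σ-involutive z))
                        (cong σ (only-y (σ z) (covers-act⁻ M z cz) (trans (σ-preserves x z) xz)))

    act-mono : ∀ M M' → M ⊆ₘ M' → act M ⊆ₘ act M'
    act-mono M M' M⊆M' x y p =
      trans (fromFun-∋ _ x y) (M⊆M' (σ x) (σ y) (trans (sym (fromFun-∋ _ x y)) p))

    act-maximal : ∀ M → IsMaxInducedMatching H M → IsMaxInducedMatching H (act M)
    act-maximal M (induced , maximal) = act-induced M induced , λ M' induced' actM⊆M' →
      let M≡actM' = maximal (act M') (act-induced M' induced')
                      (subst (_⊆ₘ act M') (act-involutive M) (act-mono (act M) M' actM⊆M'))
      in trans (cong act M≡actM') (act-involutive M')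

  -- G [ u ⇒ v ] is the pull-back of G along `redirect u v`, which sends u to v.
  redirect : Fin n → Fin n → Fin n → Fin n
  redirect u v x with x ≟ u
  ... | yes _ = v
  ... | no _  = x

  redirect-u : ∀ u v → redirect u v u ≡ v
  redirect-u u v with u ≟ u
  ... | yes _  = refl
  ... | no u≢u = ⊥-elim (u≢u refl)

  redirect-v : ∀ u v → redirect u v v ≡ v
  redirect-v u v with v ≟ u
  ... | yes _ = refl
  ... | no _  = refl

  redirect-other : ∀ u v x → x ≢ u → redirect u v x ≡ x
  redirect-other u v x x≢u with x ≟ u
  ... | yes x≡u = ⊥-elim (x≢u x≡u)
  ... | no _    = refl

  redirect-self : ∀ u x → redirect u u x ≡ x
  redirect-self u x with x ≟ u
  ... | yes x≡u = sym x≡u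
  ... | no _    = refl

  shift-pullback : ∀ G u v x y → shiftAdj G u v x y ≡ adj G (redirect u v x) (redirect u v y)
  shift-pullback G u v x y with x ≟ u | y ≟ u
  ... | yes _ | yes _ = sym (adj-irr G v)
  ... | yes _ | no _  = refl
  ... | no _  | yes _ = adj-sym G v x
  ... | no _  | no _  = refl

  shift-off-u : ∀ G u v x y → x ≢ u → y ≢ u → shiftAdj G u v x y ≡ adj G x y
  shift-off-u G u v x y x≢u y≢u =
    trans (shift-pullback G u v x y) (cong₂ (adj G) (redirect-other u v x x≢u) (redirect-other u v y y≢u))

  shift-self : ∀ G u x y → shiftAdj G u u x y ≡ adj G x y
  shift-self G u x y = trans (shift-pullback G u u x y) (cong₂ (adj G) (redirect-self u x) (redirect-self u y))

  twins : ∀ G u v y → shiftAdj G u v u y ≡ shiftAdj G u v v y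
  twins G u v y = begin
    shiftAdj G u v u y                             ≡⟨ shift-pullback G u v u y ⟩
    adj G (redirect u v u) (redirect u v y)        ≡⟨ cong (λ r → adj G r (redirect u v y))
                                                         (trans (redirect-u u v) (sym (redirect-v u v))) ⟩
    adj G (redirect u v v) (redirect u v y)        ≡⟨ sym (shift-pullback G u v v y) ⟩
    shiftAdj G u v v y                             ∎
    where open ≡-Reasoning

  shift-agrees-off-u : ∀ G u v K → ¬ Covers K u →
    ∀ x y → Covers K x → Covers K y → shiftAdj G u v x y ≡ adj G x y
  shift-agrees-off-u G u v K K-avoids-u x y cx cy =
    shift-off-u G u v x y (avoided cx) (avoided cy)
    where
    avoided : ∀ {z} → Covers K z → z ≢ u
    avoided cz z≡u = K-avoids-u (subst (Covers K) z≡u cz)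

  transpose-at-i : ∀ (i j : Fin n) → transpose i j i ≡ j
  transpose-at-i i j rewrite dec-true (i ≟ i) refl = refl

  transpose-at-j : ∀ (i j : Fin n) → transpose i j j ≡ i
  transpose-at-j i j with j ≟ i
  ... | yes j≡i = j≡i
  ... | no _ rewrite dec-true (j ≟ j) refl = refl

  transpose-elsewhere : ∀ (i j k : Fin n) → k ≢ i → k ≢ j → transpose i j k ≡ k
  transpose-elsewhere i j k k≢i k≢j with k ≟ i
  ... | yes k≡i = ⊥-elim (k≢i k≡i)
  ... | no _ with k ≟ j
  ...   | yes k≡j = ⊥-elim (k≢j k≡j)
  ...   | no _    = refl

  data Position (u v x : Fin n) : Set where
    at-u      : x ≡ u → Position u v x
    at-v      : x ≡ v → Position u v x
    elsewhere : x ≢ u → x ≢ v → Position u v x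

  position : ∀ u v x → Position u v x
  position u v x with x ≟ u | x ≟ v
  ... | yes x≡u | _       = at-u x≡u
  ... | no _    | yes x≡v = at-v x≡v
  ... | no x≢u  | no x≢v  = elsewhere x≢u x≢v

  transpose-involutive : ∀ u v x → transpose u v (transpose u v x) ≡ x
  transpose-involutive u v x with position u v x
  ... | at-u refl = trans (cong (transpose u v) (transpose-at-i u v)) (transpose-at-j u v)
  ... | at-v refl = trans (cong (transpose u v) (transpose-at-j u v)) (transpose-at-i u v)
  ... | elsewhere x≢u x≢v =
    trans (cong (transpose u v) (transpose-elsewhere u v x x≢u x≢v)) (transpose-elsewhere u v x x≢u x≢v)

  redirect-transpose : ∀ u v x → redirect u v (transpose u v x) ≡ redirect u v x
  redirect-transpose u v x with position u v x
  ... | at-u refl =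
    trans (cong (redirect u v) (transpose-at-i u v)) (trans (redirect-v u v) (sym (redirect-u u v)))
  ... | at-v refl =
    trans (cong (redirect u v) (transpose-at-j u v)) (trans (redirect-u u v) (sym (redirect-v u v)))
  ... | elsewhere x≢u x≢v = cong (redirect u v) (transpose-elsewhere u v x x≢u x≢v)

  -- Swapping twins is an automorphism: redirect u v does not see the swap.
  transpose-automorphism : ∀ G u v x y →
    shiftAdj G u v (transpose u v x) (transpose u v y) ≡ shiftAdj G u v x y
  transpose-automorphism G u v x y = begin
    shiftAdj G u v (transpose u v x) (transpose u v y)
      ≡⟨ shift-pullback G u v (transpose u v x) (transpose u v y) ⟩
    adj G (redirect u v (transpose u v x)) (redirect u v (transpose u v y))
      ≡⟨ cong₂ (adj G) (redirect-transpose u v x) (redirect-transpose u v y) ⟩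
    adj G (redirect u v x) (redirect u v y)
      ≡⟨ sym (shift-pullback G u v x y) ⟩
    shiftAdj G u v x y
      ∎
    where open ≡-Reasoning

  -- Distinct twins are never both covered by an induced matching: the partner
  -- of u would be a covered common neighbour of u and v.
  twins-not-both-covered : ∀ G u v M → u ≢ v → IsInducedMatching (G [ u ⇒ v ]) M →
    Covers M u → ¬ Covers M v
  twins-not-both-covered G u v M u≢v induced (w , uw) cv =
    u≢v (common-neighbour (G [ u ⇒ v ]) M induced w-covered (w , uw) cv w~u w~v)
    where
    edge-set : IsEdgeSet (G [ u ⇒ v ]) M
    edge-set = proj₁ (proj₁ induced)
    w-covered : Covers M w
    w-covered = partner-covered (G [ u ⇒ v ]) M edge-set uw
    u~w : shiftAdj G u v u w ≡ true
    u~w = proj₂ edge-set u w uw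
    w~u : shiftAdj G u v w u ≡ true
    w~u = trans (shiftSym G u v w u) u~w
    w~v : shiftAdj G u v w v ≡ true
    w~v = trans (shiftSym G u v w v) (trans (sym (twins G u v w)) u~w)

  -- A maximal induced matching M of G avoiding u has no extension in G [ u ⇒ v ]
  -- covering u: the swap would turn it into one of G avoiding u, containing M
  -- and covering v.
  avoiding-u-inextensible : ∀ G u v M M' → u ≢ v → IsMaxInducedMatching G M → ¬ Covers M u →
    IsInducedMatching (G [ u ⇒ v ]) M' → M ⊆ₘ M' → ¬ Covers M' u
  avoiding-u-inextensible G u v M M' u≢v (M-induced , maximal) M-avoids-u induced' M⊆M' M'-covers-u =
    M'-avoids-v (covers-mono M M' M⊆M' (subst (λ K → Covers K v) (sym M≡K) K-covers-v))
    where
    open Automorphism (G [ u ⇒ v ]) (transpose u v) (transpose-involutive u v) (transpose-automorphism G u v)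

    M'-avoids-v : ¬ Covers M' v
    M'-avoids-v = twins-not-both-covered G u v M' u≢v induced' M'-covers-u

    K : Matrix n
    K = act M'

    K-avoids-u : ¬ Covers K u
    K-avoids-u c = M'-avoids-v (subst (Covers M') (transpose-at-i u v) (covers-act⁻ M' u c))

    K-covers-v : Covers K v
    K-covers-v = covers-act M' v (subst (Covers M') (sym (transpose-at-j u v)) M'-covers-u)

    fixed : ∀ z → Covers M z → transpose u v z ≡ z
    fixed z cz = transpose-elsewhere u v z
      (λ z≡u → M-avoids-u (subst (Covers M) z≡u cz))
      (λ z≡v → M'-avoids-v (covers-mono M M' M⊆M' (subst (Covers M) z≡v cz)))

    M⊆K : M ⊆ₘ K
    M⊆K x y xy = begin
      K ∋ x , y                              ≡⟨ fromFun-∋ _ x y ⟩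
      M' ∋ transpose u v x , transpose u v y ≡⟨ cong₂ (M' ∋_,_) (fixed x (y , xy)) (fixed y y-covered) ⟩
      M' ∋ x , y                             ≡⟨ M⊆M' x y xy ⟩
      true                                   ∎
      where
      open ≡-Reasoning
      y-covered : Covers M y
      y-covered = partner-covered G M (proj₁ (proj₁ M-induced)) xy

    K-induced-in-G : IsInducedMatching G K
    K-induced-in-G = transfer-induced (G [ u ⇒ v ]) G K (shift-agrees-off-u G u v K K-avoids-u)
                       (act-induced M' induced')

    M≡K : M ≡ K
    M≡K = maximal K K-induced-in-G M⊆K

  avoiding-u-stays-maximal : ∀ G u v M → IsMaxInducedMatching G M → ¬ Covers M u →
    IsMaxInducedMatching (G [ u ⇒ v ]) M
  avoiding-u-stays-maximal G u v M M-max@(M-induced , maximal) M-avoids-u =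
    transfer-induced G (G [ u ⇒ v ]) M
      (λ x y cx cy → sym (shift-agrees-off-u G u v M M-avoids-u x y cx cy)) M-induced
    , maximal'
    where
    maximal' : ∀ M' → IsInducedMatching (G [ u ⇒ v ]) M' → M ⊆ₘ M' → M ≡ M'
    maximal' M' induced' M⊆M' with u ≟ v | covers? M' u
    ... | yes refl | _ =
      maximal M' (transfer-induced (G [ u ⇒ u ]) G M' (λ x y _ _ → shift-self G u x y) induced') M⊆M'
    ... | no u≢v | yes M'-covers-u =
      ⊥-elim (avoiding-u-inextensible G u v M M' u≢v M-max M-avoids-u induced' M⊆M' M'-covers-u)
    ... | no _ | no M'-avoids-u =
      maximal M' (transfer-induced (G [ u ⇒ v ]) G M' (shift-agrees-off-u G u v M' M'-avoids-u) induced')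
        M⊆M'

  CoveringMIM : Graph n → Fin n → Matrix n → Set
  CoveringMIM G x M = IsMaxInducedMatching G M × Covers M x

  injection-into-shift : ∀ G u v → (∀ M → IsMaxInducedMatching G M → ¬ (Covers M u × Covers M v)) →
    CoveringMIM G u ≤card CoveringMIM G v →
    IsMaxInducedMatching G ≤card IsMaxInducedMatching (G [ u ⇒ v ])
  injection-into-shift G u v never-both (g , g-into , g-injective) = f , f-into , f-injective
    where
    open Automorphism (G [ u ⇒ v ]) (transpose u v) (transpose-involutive u v) (transpose-automorphism G u v)

    -- The injection; its two kinds of values are told apart by covering u.
    f : Matrix n → Matrix n
    f M with covers? M u
    ... | yes _ = act (g M)
    ... | no _  = M

    moved : ∀ M → CoveringMIM G u M → CoveringMIM (G [ u ⇒ v ]) u (act (g M))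
    moved M M-covering with g-into M M-covering
    ... | gM-max , gM-covers-v =
        act-maximal (g M) (avoiding-u-stays-maximal G u v (g M) gM-max gM-avoids-u)
      , covers-act (g M) u (subst (Covers (g M)) (sym (transpose-at-i u v)) gM-covers-v)
      where
      gM-avoids-u : ¬ Covers (g M) u
      gM-avoids-u gM-covers-u = never-both (g M) gM-max (gM-covers-u , gM-covers-v)

    f-into : ∀ M → IsMaxInducedMatching G M → IsMaxInducedMatching (G [ u ⇒ v ]) (f M)
    f-into M M-max with covers? M u
    ... | yes M-covers-u  = proj₁ (moved M (M-max , M-covers-u))
    ... | no M-avoids-u   = avoiding-u-stays-maximal G u v M M-max M-avoids-u

    f-injective : ∀ M M' → IsMaxInducedMatching G M → IsMaxInducedMatching G M' →
                  f M ≡ f M' → M ≡ M'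
    f-injective M M' M-max M'-max e with covers? M u | covers? M' u
    ... | yes cu | yes cu' = g-injective M M' (M-max , cu) (M'-max , cu') (act-injective (g M) (g M') e)
    ... | yes cu | no nu'  = ⊥-elim (nu' (subst (λ K → Covers K u) e (proj₂ (moved M (M-max , cu)))))
    ... | no nu  | yes cu' = ⊥-elim (nu (subst (λ K → Covers K u) (sym e) (proj₂ (moved M' (M'-max , cu')))))
    ... | no _   | no _    = e

  covering-comparable : ∀ G u v →
    CoveringMIM G u ≤card CoveringMIM G v ⊎ CoveringMIM G v ≤card CoveringMIM G u
  covering-comparable G u v = compare matrices matrices-complete (covering? u) (covering? v)
    where
    open FiniteComparison _≟ₘ_ using (compare)
    covering? : ∀ x M → Dec (CoveringMIM G x M)
    covering? x M = maximal? G M ×-dec covers? M x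

lemma1 : ∀ {n} (G : Graph n) (u v : Fin n) →
    (∀ M → IsMaxInducedMatching G M → ¬ (Covers M u × Covers M v)) →
    (IsMaxInducedMatching G ≤card IsMaxInducedMatching (G [ u ⇒ v ]))
    ⊎ (IsMaxInducedMatching G ≤card IsMaxInducedMatching (G [ v ⇒ u ]))
lemma1 G u v never-both = ⊎-map (injection-into-shift G u v never-both)
                                (injection-into-shift G v u never-both-swapped)
                                (covering-comparable G u v)
  where
  never-both-swapped : ∀ M → IsMaxInducedMatching G M → ¬ (Covers M v × Covers M u)
  never-both-swapped M M-max (cv , cu) = never-both M M-max (cu , cv)
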